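{- Let $(G,P)$ be a polarized generalized graph having a complete left walk, with $S \ge 3$ vertices. Then there exists a polarized generalized graph $(G',P')$ that has a complete left walk and has no left walk of length $1$ or $2$, that differs from $G$ only by the removal of some edges (so $G$ and $G'$ have the same vertex set), such that $\gamma(G',P')=\gamma(G,P)$ and $V_r(G')_v = V_r(G)_v$ for every vertex $v$.
   Context: Generalized graphs are finite connected graphs with loops and multiple edges allowed; $S$, $A$ are the numbers of vertices and edges. A polarization $P$ is a choice, at each vertex $p$, of a cyclic order on the oriented edges based at $p$ (a loop gives two). It defines a permutation $\tau$ of oriented edges: for $(o,p)$ arriving at $p$, $\tau(o,p)=(p,q)$ where $(p,q)$ immediately follows $(p,o)$ in the cyclic order at $p$. Orbits of $\tau$ are left walks; the length of a left walk is its number of oriented edges; $F$ is the number of left walks; $\gamma(G,P)=1-\frac{S-A+F}{2}$. A left walk is complete if it traverses every unoriented edge at least once. A reduced subgraph $G_r$ of $G$ has the same vertices, no loops, and exactly one edge of $G$ between any two distinct vertices joined in $G$; the reduced valence $V_r(G)_v$ of a vertex $v$ is its valence in $G_r$ (i.e., the number of distinct vertices $w\ne v$ adjacent to $v$ in $G$). -}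

module Defs where

open import Data.Nat using (ℕ; zero; suc; _+_; _*_; _≤ᵇ_)
open import Data.Fin using (Fin; toℕ; _≟_)
open import Data.Bool using (Bool; true; false; if_then_else_; _∧_; _∨_; not)
open import Data.Product using (_×_; _,_; proj₁; proj₂; Σ; ∃; ∃-syntax)
open import Data.List using (List; []; _∷_; length; concatMap; allFin; upTo; filterᵇ)
open import Data.Bool.ListAction using (all; any)
open import Relation.Binary.PropositionalEquality using (_≡_; _≢_)
open import Relation.Nullary.Decidable using (⌊_⌋)
open import Function using (_∘_)
open import Function.Definitions using (Injective)
open import Data.Rational using (ℚ; 1ℚ; _/_) renaming (_-_ to _-ℚ_)
open import Data.Integer using (ℤ; +_) renaming (_+_ to _+ℤ_; _-_ to _-ℤ_)

iter : {X : Set} → ℕ → (X → X) → X → X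
iter zero    f x = x
iter (suc n) f x = f (iter n f x)

-- A generalized graph on the vertex set Fin S: A edges (loops and multiple
-- edges allowed); edge e joins proj₁ (ends e) and proj₂ (ends e).
record GenGraph (S : ℕ) : Set where
  field
    A    : ℕ
    ends : Fin A → Fin S × Fin S

-- Oriented edges: (e , true) goes proj₁ (ends e) → proj₂ (ends e),
-- (e , false) the opposite way.  A loop thus gives two oriented edges.
Dart : ℕ → Set
Dart A = Fin A × Bool

rev : {A : ℕ} → Dart A → Dart A
rev (e , b) = e , not b

module _ {S : ℕ} (G : GenGraph S) where
  open GenGraph G

  tail : Dart A → Fin S
  tail (e , true)  = proj₁ (ends e)
  tail (e , false) = proj₂ (ends e)

  head : Dart A → Fin S
  head (e , true)  = proj₂ (ends e)
  head (e , false) = proj₁ (ends e)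

  data Walk : Fin S → Fin S → Set where
    stay : ∀ {u} → Walk u u
    step : ∀ {v} (d : Dart A) → Walk (head d) v → Walk (tail d) v

  Connected : Set
  Connected = ∀ u v → Walk u v

  -- A polarization: a cyclic order at each vertex on the oriented edges
  -- based there, given as the successor permutation σ, which preserves the
  -- base vertex and is transitive (a single cycle) on the darts at each vertex.
  record Polarization : Set where
    field
      σ        : Dart A → Dart A
      σ⁻¹      : Dart A → Dart A
      σσ⁻¹     : ∀ d → σ (σ⁻¹ d) ≡ d
      σ⁻¹σ     : ∀ d → σ⁻¹ (σ d) ≡ d
      σ-tail   : ∀ d → tail (σ d) ≡ tail d
      σ-cyclic : ∀ d d' → tail d ≡ tail d' → ∃[ k ] iter k σ d ≡ d'

  τ : Polarization → Dart A → Dart A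
  τ P = Polarization.σ P ∘ rev

  allDarts : List (Dart A)
  allDarts = concatMap (λ e → (e , true) ∷ (e , false) ∷ []) (allFin A)

  rank : Dart A → ℕ
  rank (e , b) = 2 * toℕ e + (if b then 1 else 0)

  -- d is the rank-minimal element of its τ-orbit (the orbit of d is
  -- {τ^k d | k < 2A} since τ is a permutation of the 2A darts)
  isOrbitMin : Polarization → Dart A → Bool
  isOrbitMin P d = all (λ k → rank d ≤ᵇ rank (iter k (τ P) d)) (upTo (2 * A))

  numLeftWalks : Polarization → ℕ
  numLeftWalks P = length (filterᵇ (isOrbitMin P) allDarts)

  genus : Polarization → ℚ
  genus P = 1ℚ -ℚ ((+ S -ℤ + A +ℤ + numLeftWalks P) / 2)

  HasCompleteLeftWalk : Polarization → Set
  HasCompleteLeftWalk P = ∃[ d ] ∀ (e : Fin A) → ∃[ k ] proj₁ (iter k (τ P) d) ≡ e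

  NoLeftWalkOfLength1or2 : Polarization → Set
  NoLeftWalkOfLength1or2 P = ∀ d → (τ P d ≢ d) × (τ P (τ P d) ≢ d)

  adjacentᵇ : Fin S → Fin S → Bool
  adjacentᵇ v w = any (λ e → (⌊ proj₁ (ends e) ≟ v ⌋ ∧ ⌊ proj₂ (ends e) ≟ w ⌋)
                            ∨ (⌊ proj₁ (ends e) ≟ w ⌋ ∧ ⌊ proj₂ (ends e) ≟ v ⌋))
                      (allFin A)

  reducedValence : Fin S → ℕ
  reducedValence v = length (filterᵇ (λ w → not ⌊ w ≟ v ⌋ ∧ adjacentᵇ v w) (allFin S))

EdgeRemoval : {S : ℕ} → GenGraph S → GenGraph S → Set
EdgeRemoval G' G = Σ (Fin (GenGraph.A G') → Fin (GenGraph.A G)) λ ι →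
  Injective _≡_ _≡_ ι × (∀ e → GenGraph.ends G' e ≡ GenGraph.ends G (ι e))

-- A left walk (x) of length 1 forces x to be a loop, and a left walk
-- (x d) of length 2 forces d to run parallel to x; either way the edge of x is redundant: deleting it
-- (and splicing both its darts out of the rotation σ) keeps the graph connected and every reduced
-- valence, and removes one edge. It also removes exactly one left walk, so γ = 1 - (S - A + F)/2 is
-- unchanged. To see this, transport the left-walk permutation of the smaller graph back to G with both
-- deleted darts as fixed points: it arises from τ by splicing darts out of (and into) cycles, and each
-- splice changes the number of cycles by one; cycles are counted by their rank-minimal darts, as in F.
-- The complete left walk passes through the reverse of x, since S ≥ 3 and connectedness exclude the
-- graphs whose edges all lie on the short walk, and what remains of it is a complete left walk of the
-- smaller graph.

module Submission where

open import Defs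
open import Data.Bool as Bool using (Bool; true; false; not; T; T?; if_then_else_; _∧_; _∨_)
import Data.Bool.Properties as Boolₚ
open import Data.Bool.ListAction using (all; and; any)
open import Data.Empty using (⊥; ⊥-elim)
open import Data.Fin as Fin using (Fin; zero; suc; toℕ; punchIn; punchOut; _≟_)
import Data.Fin.Properties as Finₚ
import Data.Integer as ℤ
open import Data.Integer.Tactic.RingSolver using (solve-∀)
open import Data.List using (List; []; _∷_; length; concatMap; allFin; upTo; filterᵇ; tabulate)
import Data.List.Properties as Listₚ
import Data.List.Relation.Unary.All as All
import Data.List.Relation.Unary.All.Properties as Allₚ
import Data.List.Relation.Unary.Any as Any
import Data.List.Relation.Unary.Any.Properties as Anyₚ
open import Data.List.Membership.Propositional using (lose)
open import Data.List.Membership.Propositional.Properties using (∈-allFin; ∈-upTo⁺)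
open import Data.Nat using (ℕ; zero; suc; _+_; _*_; _∸_; _≤_; _<_; _≤ᵇ_; z≤n; s≤s)
open import Data.Nat.DivMod using (_%_; m≡m%n+[m/n]*n; m%n<n) renaming (_/_ to _/ℕ_)
import Data.Nat.Properties as ℕₚ
open import Algebra.Properties.CommutativeMonoid.Sum ℕₚ.+-0-commutativeMonoid using (sum; sum-remove; sum-cong-≗)
open import Data.Product using (Σ; ∃; ∃-syntax; _×_; _,_; proj₁; proj₂)
open import Data.Product.Properties using (≡-dec)
import Data.Rational as ℚ
open import Data.Sum using (_⊎_; inj₁; inj₂)
open import Data.Unit using (tt)
open import Function using (_∘_; id)
open import Function.Definitions using (Injective)
open import Relation.Binary.Definitions using (DecidableEquality; tri<; tri≈; tri>)
open import Relation.Binary.PropositionalEquality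
open import Relation.Nullary using (Dec; yes; no; ¬_)
open import Relation.Nullary.Decidable using (⌊_⌋; map′; _⊎-dec_)

private
  variable
    X : Set

iter-+ : ∀ m n (f : X → X) x → iter (m + n) f x ≡ iter m f (iter n f x)
iter-+ zero    n f x = refl
iter-+ (suc m) n f x = cong f (iter-+ m n f x)

iter-suc : ∀ k (f : X → X) x → iter (suc k) f x ≡ iter k f (f x)
iter-suc k f x = begin
  iter (suc k) f x ≡⟨ cong (λ n → iter n f x) (ℕₚ.+-comm 1 k) ⟩
  iter (k + 1) f x ≡⟨ iter-+ k 1 f x ⟩
  iter k f (f x)   ∎
  where open ≡-Reasoning

iter-cong : ∀ k {f g : X → X} → f ≗ g → ∀ x → iter k f x ≡ iter k g x
iter-cong zero    f≗g x = refl
iter-cong (suc k) {f} f≗g x = trans (cong f (iter-cong k f≗g x)) (f≗g _)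

iter-commute : ∀ {Y : Set} k {f : X → X} {g : Y → Y} (h : Y → X) →
               (∀ y → h (g y) ≡ f (h y)) → ∀ y → h (iter k g y) ≡ iter k f (h y)
iter-commute zero    h comm y = refl
iter-commute (suc k) {f} h comm y = trans (comm _) (cong f (iter-commute k h comm y))

iter-fixed : ∀ k {f : X → X} {x} → f x ≡ x → iter k f x ≡ x
iter-fixed zero    fx≡x = refl
iter-fixed (suc k) {f} fx≡x = trans (cong f (iter-fixed k fx≡x)) fx≡x

iter-*-period : ∀ m {p} {f : X → X} {x} → iter p f x ≡ x → iter (m * p) f x ≡ x
iter-*-period zero    eq = refl
iter-*-period (suc m) {p} {f} {x} eq =
  trans (iter-+ p (m * p) f x) (trans (cong (iter p f) (iter-*-period m eq)) eq)

Reach : (X → X) → X → X → Set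
Reach f x y = ∃[ k ] iter k f x ≡ y

module _ {f : X → X} where

  Reach-refl : ∀ {x} → Reach f x x
  Reach-refl = 0 , refl

  Reach-step : ∀ {x} → Reach f x (f x)
  Reach-step = 1 , refl

  Reach-trans : ∀ {x y z} → Reach f x y → Reach f y z → Reach f x z
  Reach-trans {x} (k , refl) (m , refl) = m + k , iter-+ m k f x

  Reach-unstep : ∀ {x y} → x ≢ y → Reach f x y → Reach f (f x) y
  Reach-unstep x≢y (zero  , eq) = ⊥-elim (x≢y eq)
  Reach-unstep {x} x≢y (suc k , eq) = k , trans (sym (iter-suc k f x)) eq

Reach-fixed : ∀ {f : X → X} {a c} → f a ≡ a → Reach f a c → c ≡ a
Reach-fixed fa≡a (k , refl) = iter-fixed k fa≡a

Reach-2-cycle : ∀ {f : X → X} {a b c} → f a ≡ b → f b ≡ a → Reach f a c → c ≡ a ⊎ c ≡ b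
Reach-2-cycle {f = f} {a} fa≡b fb≡a (k , refl) = cycle k
  where
  cycle : ∀ k → iter k f a ≡ a ⊎ iter k f a ≡ _
  cycle zero = inj₁ refl
  cycle (suc k) with cycle k
  ... | inj₁ eq = inj₂ (trans (cong f eq) fa≡b)
  ... | inj₂ eq = inj₁ (trans (cong f eq) fb≡a)

Reach-cong : ∀ {f g : X → X} → f ≗ g → ∀ {x y} → Reach f x y → Reach g x y
Reach-cong f≗g {x} (k , eq) = k , trans (sym (iter-cong k f≗g x)) eq

-- By pigeonhole, an injective self-map of a type injecting into Fin n is periodic with period ≤ n;
-- in particular it is a permutation.
module FiniteInjection {n : ℕ} (code : X → Fin n) (code-injective : Injective _≡_ _≡_ code)
                       {f : X → X} (f-injective : Injective _≡_ _≡_ f) where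

  private
    iter-cancel : ∀ a m x → iter (a + m) f x ≡ iter a f x → iter m f x ≡ x
    iter-cancel zero    m x eq = eq
    iter-cancel (suc a) m x eq = iter-cancel a m x (f-injective eq)

  period : ∀ x → ∃[ p ] suc p ≤ n × iter (suc p) f x ≡ x
  period x with Finₚ.pigeonhole (ℕₚ.n<1+n n) (λ k → code (iter (toℕ k) f x))
  ... | i , j , i<j , eq = p , p<n , iter-cancel (toℕ i) (suc p) x i+p≡i
    where
    p = toℕ j ∸ suc (toℕ i)
    i+sp≡j : toℕ i + suc p ≡ toℕ j
    i+sp≡j = trans (ℕₚ.+-suc (toℕ i) p) (ℕₚ.m+[n∸m]≡n i<j)
    p<n : suc p ≤ n
    p<n = ℕₚ.≤-trans (ℕₚ.m≤n+m (suc p) (toℕ i))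
            (ℕₚ.≤-trans (ℕₚ.≤-reflexive i+sp≡j) (ℕₚ.≤-pred (Finₚ.toℕ<n j)))
    i+p≡i : iter (toℕ i + suc p) f x ≡ iter (toℕ i) f x
    i+p≡i = trans (cong (λ m → iter m f x) i+sp≡j) (sym (code-injective eq))

  iter-reduce : ∀ x k → ∃[ r ] r < n × iter r f x ≡ iter k f x
  iter-reduce x k with period x
  ... | p , sp≤n , periodic = k % suc p , ℕₚ.<-≤-trans (m%n<n k (suc p)) sp≤n , (begin
    iter (k % suc p) f x
      ≡⟨ cong (iter (k % suc p) f) (sym (iter-*-period (k /ℕ suc p) periodic)) ⟩
    iter (k % suc p) f (iter (k /ℕ suc p * suc p) f x)
      ≡⟨ sym (iter-+ (k % suc p) _ f x) ⟩
    iter (k % suc p + k /ℕ suc p * suc p) f x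
      ≡⟨ cong (λ m → iter m f x) (sym (m≡m%n+[m/n]*n k (suc p))) ⟩
    iter k f x ∎)
    where open ≡-Reasoning

  Reach-sym : ∀ {x y} → Reach f x y → Reach f y x
  Reach-sym {x} (k , refl) with period x
  ... | p , _ , periodic = k * suc p ∸ k , (begin
    iter (k * suc p ∸ k) f (iter k f x) ≡⟨ sym (iter-+ (k * suc p ∸ k) k f x) ⟩
    iter (k * suc p ∸ k + k) f x        ≡⟨ cong (λ m → iter m f x) (ℕₚ.m∸n+n≡m (ℕₚ.m≤m*n k (suc p))) ⟩
    iter (k * suc p) f x                ≡⟨ iter-*-period k periodic ⟩
    x                                   ∎)
    where open ≡-Reasoning

  inverse : X → X
  inverse y = iter (proj₁ (period y)) f y

  f∘inverse : ∀ y → f (inverse y) ≡ y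
  f∘inverse y = proj₂ (proj₂ (period y))

  inverse∘f : ∀ x → inverse (f x) ≡ x
  inverse∘f x = f-injective (f∘inverse (f x))

T-injective : ∀ {a b} → (T a → T b) → (T b → T a) → a ≡ b
T-injective {true}  {true}  _   _   = refl
T-injective {false} {false} _   _   = refl
T-injective {true}  {false} a⇒b _   = ⊥-elim (a⇒b tt)
T-injective {false} {true}  _   b⇒a = ⊥-elim (b⇒a tt)

bit : Bool → ℕ
bit b = if b then 1 else 0

bit≤1 : ∀ b → bit b ≤ 1
bit≤1 false = z≤n
bit≤1 true  = s≤s z≤n

2*+bit-< : ∀ {m n} s t → m < n → 2 * m + bit s < 2 * n + bit t
2*+bit-< {m} {n} s t m<n = begin-strict
  2 * m + bit s ≤⟨ ℕₚ.+-monoʳ-≤ (2 * m) (bit≤1 s) ⟩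
  2 * m + 1     ≡⟨ ℕₚ.+-comm (2 * m) 1 ⟩
  1 + 2 * m     <⟨ ℕₚ.n<1+n _ ⟩
  2 + 2 * m     ≡⟨ sym (ℕₚ.*-suc 2 m) ⟩
  2 * suc m     ≤⟨ ℕₚ.*-monoʳ-≤ 2 m<n ⟩
  2 * n         ≤⟨ ℕₚ.m≤m+n (2 * n) (bit t) ⟩
  2 * n + bit t ∎
  where open ℕₚ.≤-Reasoning

module _ {A : ℕ} where

  _≟ᴰ_ : DecidableEquality (Dart A)
  _≟ᴰ_ = ≡-dec Fin._≟_ Bool._≟_

  dartRank : Dart A → ℕ
  dartRank (e , b) = 2 * toℕ e + bit b

  dartRank-injective : Injective _≡_ _≡_ dartRank
  dartRank-injective {e , s} {e′ , t} eq with ℕₚ.<-cmp (toℕ e) (toℕ e′)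
  ... | tri< e<e′ _ _ = ⊥-elim (ℕₚ.<⇒≢ (2*+bit-< s t e<e′) eq)
  ... | tri> _ _ e′<e = ⊥-elim (ℕₚ.<⇒≢ (2*+bit-< t s e′<e) (sym eq))
  ... | tri≈ _ e≡e′ _ rewrite Finₚ.toℕ-injective e≡e′ =
    cong (e′ ,_) (bit-injective s t (ℕₚ.+-cancelˡ-≡ (2 * toℕ e′) _ _ eq))
    where
    bit-injective : ∀ s t → bit s ≡ bit t → s ≡ t
    bit-injective false false _ = refl
    bit-injective true  true  _ = refl

  dartRank< : ∀ d → dartRank d < 2 * A
  dartRank< (e , b) =
    subst (dartRank (e , b) <_) (ℕₚ.+-identityʳ (2 * A)) (2*+bit-< b false (Finₚ.toℕ<n e))

  dartCode : Dart A → Fin (2 * A)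
  dartCode d = Fin.fromℕ< (dartRank< d)

  dartCode-injective : Injective _≡_ _≡_ dartCode
  dartCode-injective {d} {d′} eq = dartRank-injective (begin
    dartRank d             ≡⟨ sym (Finₚ.toℕ-fromℕ< (dartRank< d)) ⟩
    toℕ (dartCode d)       ≡⟨ cong toℕ eq ⟩
    toℕ (dartCode d′)      ≡⟨ Finₚ.toℕ-fromℕ< (dartRank< d′) ⟩
    dartRank d′            ∎)
    where open ≡-Reasoning

  module DartPermutation {f : Dart A → Dart A} (f-injective : Injective _≡_ _≡_ f) =
    FiniteInjection dartCode dartCode-injective f-injective

  IsOrbitMin : (Dart A → Dart A) → Dart A → Set
  IsOrbitMin f d = ∀ {m} → Reach f d m → dartRank d ≤ dartRank m

  isOrbitMinᵇ : (Dart A → Dart A) → Dart A → Bool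
  isOrbitMinᵇ f d = all (λ k → dartRank d ≤ᵇ dartRank (iter k f d)) (upTo (2 * A))

  module _ {f : Dart A → Dart A} where

    private
      rank≤ᵇ : Dart A → ℕ → Bool
      rank≤ᵇ d k = dartRank d ≤ᵇ dartRank (iter k f d)

    isOrbitMinᵇ⇒IsOrbitMin : Injective _≡_ _≡_ f → ∀ {d} → T (isOrbitMinᵇ f d) → IsOrbitMin f d
    isOrbitMinᵇ⇒IsOrbitMin f-injective {d} t (k , refl) =
      subst (λ m → dartRank d ≤ dartRank m) (proj₂ (proj₂ red))
        (ℕₚ.≤ᵇ⇒≤ (dartRank d) (dartRank (iter (proj₁ red) f d))
          (All.lookup (Allₚ.all⁺ (rank≤ᵇ d) (upTo (2 * A)) t) (∈-upTo⁺ (proj₁ (proj₂ red)))))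
      where
      red = DartPermutation.iter-reduce f-injective d k

    IsOrbitMin⇒isOrbitMinᵇ : ∀ {d} → IsOrbitMin f d → T (isOrbitMinᵇ f d)
    IsOrbitMin⇒isOrbitMinᵇ {d} min =
      Allₚ.all⁻ (rank≤ᵇ d) {xs = upTo (2 * A)} (All.tabulate (λ {k} _ → ℕₚ.≤⇒≤ᵇ (min (k , refl))))

    ¬isOrbitMinᵇ⇒smaller : ∀ {d} → ¬ T (isOrbitMinᵇ f d) → ∃[ m ] Reach f d m × dartRank m < dartRank d
    ¬isOrbitMinᵇ⇒smaller {d} ¬min with Any.satisfied
      (Allₚ.¬All⇒Any¬ (T? ∘ rank≤ᵇ d) (upTo (2 * A)) (¬min ∘ Allₚ.all⁻ (rank≤ᵇ d) {xs = upTo (2 * A)}))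
    ... | k , ¬d≤m = iter k f d , (k , refl) , ℕₚ.≰⇒> (¬d≤m ∘ ℕₚ.≤⇒≤ᵇ)

    orbitMin-exists : Injective _≡_ _≡_ f → ∀ d → ∃[ m ] Reach f d m × IsOrbitMin f m
    orbitMin-exists f-injective d = below (suc (dartRank d)) d ℕₚ.≤-refl
      where
      below : ∀ n d → dartRank d < n → ∃[ m ] Reach f d m × IsOrbitMin f m
      below (suc n) d (s≤s d≤n) with T? (isOrbitMinᵇ f d)
      ... | yes min = d , Reach-refl , isOrbitMinᵇ⇒IsOrbitMin f-injective min
      ... | no ¬min with ¬isOrbitMinᵇ⇒smaller ¬min
      ...   | m , d↝m , m<d with below n m (ℕₚ.<-≤-trans m<d d≤n)
      ...     | m′ , m↝m′ , min = m′ , Reach-trans d↝m m↝m′ , min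

    orbitMin-unique : Injective _≡_ _≡_ f → ∀ {d d′} → IsOrbitMin f d → IsOrbitMin f d′ →
                      Reach f d d′ → d ≡ d′
    orbitMin-unique f-injective min min′ d↝d′ =
      dartRank-injective (ℕₚ.≤-antisym (min d↝d′) (min′ (DartPermutation.Reach-sym f-injective d↝d′)))

  isOrbitMinᵇ-cong : ∀ {f g : Dart A → Dart A} → Injective _≡_ _≡_ f → Injective _≡_ _≡_ g → ∀ d →
                     (IsOrbitMin f d → IsOrbitMin g d) → (IsOrbitMin g d → IsOrbitMin f d) →
                     isOrbitMinᵇ f d ≡ isOrbitMinᵇ g d
  isOrbitMinᵇ-cong f-injective g-injective d f⇒g g⇒f = T-injective
    (IsOrbitMin⇒isOrbitMinᵇ ∘ f⇒g ∘ isOrbitMinᵇ⇒IsOrbitMin f-injective)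
    (IsOrbitMin⇒isOrbitMinᵇ ∘ g⇒f ∘ isOrbitMinᵇ⇒IsOrbitMin g-injective)

  darts : List (Dart A)
  darts = concatMap (λ e → (e , true) ∷ (e , false) ∷ []) (allFin A)

  count : (Dart A → Bool) → ℕ
  count p = length (filterᵇ p darts)

  orbitCount : (Dart A → Dart A) → ℕ
  orbitCount f = count (isOrbitMinᵇ f)

  edgeCount : (Dart A → Bool) → Fin A → ℕ
  edgeCount p e = bit (p (e , true)) + bit (p (e , false))

  private
    length-filterᵇ-∷ : ∀ {X : Set} (p : X → Bool) x xs →
                       length (filterᵇ p (x ∷ xs)) ≡ bit (p x) + length (filterᵇ p xs)
    length-filterᵇ-∷ p x xs with p x
    ... | true  = refl
    ... | false = refl

    count-tabulate : ∀ (p : Dart A → Bool) {n} (g : Fin n → Fin A) →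
      length (filterᵇ p (concatMap (λ e → (e , true) ∷ (e , false) ∷ []) (tabulate g))) ≡ sum (edgeCount p ∘ g)
    count-tabulate p {zero}  g = refl
    count-tabulate p {suc n} g = begin
      length (filterᵇ p ((g zero , true) ∷ (g zero , false) ∷ rest))
        ≡⟨ length-filterᵇ-∷ p _ _ ⟩
      bit (p (g zero , true)) + length (filterᵇ p ((g zero , false) ∷ rest))
        ≡⟨ cong (bit (p (g zero , true)) +_) (length-filterᵇ-∷ p _ _) ⟩
      bit (p (g zero , true)) + (bit (p (g zero , false)) + length (filterᵇ p rest))
        ≡⟨ sym (ℕₚ.+-assoc (bit (p (g zero , true))) _ _) ⟩
      edgeCount p (g zero) + length (filterᵇ p rest)
        ≡⟨ cong (edgeCount p (g zero) +_) (count-tabulate p (g ∘ suc)) ⟩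
      sum (edgeCount p ∘ g) ∎
      where
      open ≡-Reasoning
      rest = concatMap (λ e → (e , true) ∷ (e , false) ∷ []) (tabulate (g ∘ suc))

  count≡sum : ∀ p → count p ≡ sum (edgeCount p)
  count≡sum p = count-tabulate p (λ e → e)

  count-cong : ∀ {p q} → p ≗ q → count p ≡ count q
  count-cong {p} {q} p≗q = begin
    count p           ≡⟨ count≡sum p ⟩
    sum (edgeCount p) ≡⟨ sum-cong-≗ {x = edgeCount p} {y = edgeCount q}
                           (λ e → cong₂ _+_ (cong bit (p≗q (e , true))) (cong bit (p≗q (e , false)))) ⟩
    sum (edgeCount q) ≡⟨ sym (count≡sum q) ⟩
    count q           ∎
    where open ≡-Reasoning

  orbitCount-cong : ∀ {f g : Dart A → Dart A} → f ≗ g → orbitCount f ≡ orbitCount g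
  orbitCount-cong f≗g = count-cong (λ d → cong and (Listₚ.map-cong
    (λ k → cong (λ y → dartRank d ≤ᵇ dartRank y) (iter-cong k f≗g d)) (upTo (2 * A))))

count-suc : ∀ {A} {p q : Dart A → Bool} w → T (p w) → ¬ T (q w) → (∀ y → y ≢ w → p y ≡ q y) →
            count p ≡ suc (count q)
count-suc {zero} (() , _)
count-suc {suc A} {p} {q} (i , b) pw ¬qw p≡q = begin
  count p                                              ≡⟨ count≡sum p ⟩
  sum (edgeCount p)                                    ≡⟨ sum-remove {i = i} (edgeCount p) ⟩
  edgeCount p i + sum (edgeCount p ∘ punchIn i)        ≡⟨ cong₂ _+_ (at-i b pw ¬qw p≡q)
                                                            (sum-cong-≗ {x = edgeCount p ∘ punchIn i} elsewhere) ⟩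
  suc (edgeCount q i) + sum (edgeCount q ∘ punchIn i)  ≡⟨ cong suc (sym (sum-remove {i = i} (edgeCount q))) ⟩
  suc (sum (edgeCount q))                              ≡⟨ cong suc (sym (count≡sum q)) ⟩
  suc (count q)                                        ∎
  where
  open ≡-Reasoning
  elsewhere : ∀ e → edgeCount p (punchIn i e) ≡ edgeCount q (punchIn i e)
  elsewhere e = cong₂ _+_ (cong bit (p≡q _ (Finₚ.punchInᵢ≢i i e ∘ cong proj₁)))
                          (cong bit (p≡q _ (Finₚ.punchInᵢ≢i i e ∘ cong proj₁)))
  bit-true : ∀ {c} → T c → bit c ≡ 1
  bit-true {true} _ = refl
  bit-false : ∀ {c} → ¬ T c → bit c ≡ 0
  bit-false {false} _ = refl
  bit-false {true} ¬c = ⊥-elim (¬c _)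
  at-i : ∀ b → T (p (i , b)) → ¬ T (q (i , b)) → (∀ y → y ≢ (i , b) → p y ≡ q y) →
         edgeCount p i ≡ suc (edgeCount q i)
  at-i true  pw ¬qw p≡q rewrite bit-true pw | bit-false ¬qw | p≡q (i , false) (λ ()) = refl
  at-i false pw ¬qw p≡q rewrite bit-true pw | bit-false ¬qw | p≡q (i , true) (λ ()) =
    trans (ℕₚ.+-comm (bit (q (i , true))) 1) (cong suc (sym (ℕₚ.+-identityʳ _)))

module Splicing {X : Set} (_≟_ : DecidableEquality X) where

  -- splice f z takes z out of its cycle, leaving it as a fixed point.
  splice : (X → X) → X → X → X
  splice f z y with y ≟ z
  ... | yes _ = z
  ... | no  _ with f y ≟ z
  ...   | yes _ = f z
  ...   | no  _ = f y

  module _ {f : X → X} {z : X} where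

    splice-self : splice f z z ≡ z
    splice-self with z ≟ z
    ... | yes _   = refl
    ... | no  z≢z = ⊥-elim (z≢z refl)

    splice-pred : ∀ {y} → y ≢ z → f y ≡ z → splice f z y ≡ f z
    splice-pred {y} y≢z fy≡z with y ≟ z
    ... | yes y≡z = ⊥-elim (y≢z y≡z)
    ... | no  _ with f y ≟ z
    ...   | yes _    = refl
    ...   | no  fy≢z = ⊥-elim (fy≢z fy≡z)

    splice-other : ∀ {y} → y ≢ z → f y ≢ z → splice f z y ≡ f y
    splice-other {y} y≢z fy≢z with y ≟ z
    ... | yes y≡z = ⊥-elim (y≢z y≡z)
    ... | no  _ with f y ≟ z
    ...   | yes fy≡z = ⊥-elim (fy≢z fy≡z)
    ...   | no  _    = refl

  data SpliceView (f : X → X) (z y : X) : Set where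
    spliced     : y ≡ z → SpliceView f z y
    predecessor : y ≢ z → f y ≡ z → splice f z y ≡ f z → SpliceView f z y
    unchanged   : y ≢ z → f y ≢ z → splice f z y ≡ f y → SpliceView f z y

  spliceView : ∀ f z y → SpliceView f z y
  spliceView f z y with y ≟ z
  ... | yes y≡z = spliced y≡z
  ... | no  y≢z with f y ≟ z
  ...   | yes fy≡z = predecessor y≢z fy≡z (splice-pred y≢z fy≡z)
  ...   | no  fy≢z = unchanged y≢z fy≢z (splice-other y≢z fy≢z)

  module _ {f : X → X} {z : X} where

    splice-≢ : f z ≢ z → ∀ {y} → y ≢ z → splice f z y ≢ z
    splice-≢ fz≢z {y} y≢z with spliceView f z y
    ... | spliced y≡z              = ⊥-elim (y≢z y≡z)
    ... | predecessor _ _ eq       = λ s≡z → fz≢z (trans (sym eq) s≡z)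
    ... | unchanged _ fy≢z eq      = λ s≡z → fy≢z (trans (sym eq) s≡z)

    splice-fixed : Injective _≡_ _≡_ f → f z ≡ z → splice f z ≗ f
    splice-fixed f-injective fz≡z y with spliceView f z y
    ... | spliced refl             = trans splice-self (sym fz≡z)
    ... | predecessor y≢z fy≡z _   = ⊥-elim (y≢z (f-injective (trans fy≡z (sym fz≡z))))
    ... | unchanged _ _ eq         = eq

    splice-preserves : ∀ {V : Set} (t : X → V) → (∀ y → t (f y) ≡ t y) → ∀ y → t (splice f z y) ≡ t y
    splice-preserves t t∘f≡t y with spliceView f z y
    ... | spliced refl             = cong t splice-self
    ... | predecessor _ fy≡z eq    = trans (cong t eq) (trans (t∘f≡t z) (trans (cong t (sym fy≡z)) (t∘f≡t y)))
    ... | unchanged _ _ eq         = trans (cong t eq) (t∘f≡t y)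

    splice-injective : Injective _≡_ _≡_ f → Injective _≡_ _≡_ (splice f z)
    splice-injective f-injective {y} {y′} eq with spliceView f z y | spliceView f z y′
    ... | spliced y≡z | spliced y′≡z = trans y≡z (sym y′≡z)
    ... | spliced refl | predecessor y′≢z fy′≡z eq′ =
          ⊥-elim (y′≢z (f-injective (trans fy′≡z (trans (sym splice-self) (trans eq eq′)))))
    ... | spliced refl | unchanged _ fy′≢z eq′ = ⊥-elim (fy′≢z (trans (sym eq′) (trans (sym eq) splice-self)))
    ... | predecessor y≢z fy≡z eq″ | spliced refl =
          ⊥-elim (y≢z (f-injective (trans fy≡z (trans (sym splice-self) (trans (sym eq) eq″)))))
    ... | unchanged _ fy≢z eq″ | spliced refl = ⊥-elim (fy≢z (trans (sym eq″) (trans eq splice-self)))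
    ... | predecessor _ fy≡z _ | predecessor _ fy′≡z _ = f-injective (trans fy≡z (sym fy′≡z))
    ... | predecessor y≢z _ eq″ | unchanged y′≢z _ eq′ =
          ⊥-elim (y′≢z (sym (f-injective (trans (sym eq″) (trans eq eq′)))))
    ... | unchanged y≢z _ eq″ | predecessor _ _ eq′ = ⊥-elim (y≢z (f-injective (trans (sym eq″) (trans eq eq′))))
    ... | unchanged _ _ eq″ | unchanged _ _ eq′ = f-injective (trans (sym eq″) (trans eq eq′))

    Reach-splice⁻ : f z ≢ z → ∀ {y w} → y ≢ z → Reach (splice f z) y w → Reach f y w × w ≢ z
    Reach-splice⁻ fz≢z {y} y≢z (k , refl) = forward k
      where
      forward : ∀ k → Reach f y (iter k (splice f z) y) × iter k (splice f z) y ≢ z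
      forward zero = Reach-refl , y≢z
      forward (suc k) with forward k
      ... | y↝x , x≢z with spliceView f z (iter k (splice f z) y)
      ...   | spliced x≡z = ⊥-elim (x≢z x≡z)
      ...   | predecessor _ fx≡z eq =
              Reach-trans y↝x (Reach-trans (1 , fx≡z) (Reach-trans Reach-step (0 , sym eq))) , splice-≢ fz≢z x≢z
      ...   | unchanged _ _ eq = Reach-trans y↝x (1 , sym eq) , splice-≢ fz≢z x≢z

    -- Until the f-path from y meets z it is also a path of splice f z; at z the spliced map jumps to f z.
    Reach-splice⁺ : Injective _≡_ _≡_ f → ∀ {y w} → y ≢ z → Reach f y w → w ≢ z → Reach (splice f z) y w
    Reach-splice⁺ f-injective {y} y≢z (k , refl) w≢z with f z ≟ z
    ... | yes fz≡z = Reach-cong (λ x → sym (splice-fixed f-injective fz≡z x)) (k , refl)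
    ... | no  fz≢z with forward k
      where
      forward : ∀ k → (iter k f y ≢ z × Reach (splice f z) y (iter k f y))
                    ⊎ (iter k f y ≡ z × Reach (splice f z) y (f z))
      forward zero = inj₁ (y≢z , Reach-refl)
      forward (suc k) with forward k
      ... | inj₂ (x≡z , y↝fz) =
            inj₁ ((λ fx≡z → fz≢z (trans (cong f (sym x≡z)) fx≡z)) , subst (Reach _ y) (cong f (sym x≡z)) y↝fz)
      ... | inj₁ (x≢z , y↝x) with spliceView f z (iter k f y)
      ...   | spliced x≡z = ⊥-elim (x≢z x≡z)
      ...   | predecessor _ fx≡z eq = inj₂ (fx≡z , Reach-trans y↝x (1 , eq))
      ...   | unchanged _ fx≢z eq = inj₁ (fx≢z , Reach-trans y↝x (1 , eq))
    ... | inj₁ (_ , y↝w) = y↝w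
    ... | inj₂ (w≡z , _) = ⊥-elim (w≢z w≡z)

  -- insert f a b puts a fixed point a of f into the cycle of b, just before b.
  insert : (X → X) → X → X → X → X
  insert f a b y with y ≟ a
  ... | yes _ = b
  ... | no  _ with f y ≟ b
  ...   | yes _ = a
  ...   | no  _ = f y

  module _ {f : X → X} {a b : X} where

    insert-self : insert f a b a ≡ b
    insert-self with a ≟ a
    ... | yes _   = refl
    ... | no  a≢a = ⊥-elim (a≢a refl)

    insert-pred : ∀ {y} → y ≢ a → f y ≡ b → insert f a b y ≡ a
    insert-pred {y} y≢a fy≡b with y ≟ a
    ... | yes y≡a = ⊥-elim (y≢a y≡a)
    ... | no  _ with f y ≟ b
    ...   | yes _    = refl
    ...   | no  fy≢b = ⊥-elim (fy≢b fy≡b)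

    insert-other : ∀ {y} → y ≢ a → f y ≢ b → insert f a b y ≡ f y
    insert-other {y} y≢a fy≢b with y ≟ a
    ... | yes y≡a = ⊥-elim (y≢a y≡a)
    ... | no  _ with f y ≟ b
    ...   | yes fy≡b = ⊥-elim (fy≢b fy≡b)
    ...   | no  _    = refl

    module _ (f-injective : Injective _≡_ _≡_ f) (fa≡a : f a ≡ a) (b≢a : b ≢ a) where

      private
        f≢a : ∀ {y} → y ≢ a → f y ≢ a
        f≢a y≢a fy≡a = y≢a (f-injective (trans fy≡a (sym fa≡a)))

        data InsertView (y : X) : Set where
          inserted   : y ≡ a → InsertView y
          before-b   : y ≢ a → f y ≡ b → insert f a b y ≡ a → InsertView y
          unchanged′ : y ≢ a → f y ≢ b → insert f a b y ≡ f y → InsertView y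

        insertView : ∀ y → InsertView y
        insertView y with y ≟ a
        ... | yes y≡a = inserted y≡a
        ... | no  y≢a with f y ≟ b
        ...   | yes fy≡b = before-b y≢a fy≡b (insert-pred y≢a fy≡b)
        ...   | no  fy≢b = unchanged′ y≢a fy≢b (insert-other y≢a fy≢b)

        insert≢b : ∀ {y} → y ≢ a → insert f a b y ≢ b
        insert≢b {y} y≢a with f y ≟ b
        ... | yes fy≡b = λ eq → b≢a (trans (sym eq) (insert-pred y≢a fy≡b))
        ... | no  fy≢b = λ eq → fy≢b (trans (sym (insert-other y≢a fy≢b)) eq)

      splice-insert : splice (insert f a b) a ≗ f
      splice-insert y with spliceView (insert f a b) a y
      ... | spliced refl = trans splice-self (sym fa≡a)
      ... | predecessor y≢a insert≡a eq with f y ≟ b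
      ...   | yes fy≡b = trans eq (trans insert-self (sym fy≡b))
      ...   | no  fy≢b = ⊥-elim (f≢a y≢a (trans (sym (insert-other y≢a fy≢b)) insert≡a))
      splice-insert y | unchanged y≢a insert≢a eq with f y ≟ b
      ...   | yes fy≡b = ⊥-elim (insert≢a (insert-pred y≢a fy≡b))
      ...   | no  fy≢b = trans eq (insert-other y≢a fy≢b)

      insert-injective : Injective _≡_ _≡_ (insert f a b)
      insert-injective {y} {y′} eq with insertView y | insertView y′
      ... | inserted y≡a | inserted y′≡a = trans y≡a (sym y′≡a)
      ... | inserted refl | before-b y′≢a _ eq′ = ⊥-elim (b≢a (trans (sym insert-self) (trans eq eq′)))
      ... | inserted refl | unchanged′ y′≢a _ _ = ⊥-elim (insert≢b y′≢a (trans (sym eq) insert-self))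
      ... | before-b y≢a _ eq″ | inserted refl = ⊥-elim (b≢a (trans (sym insert-self) (trans (sym eq) eq″)))
      ... | unchanged′ y≢a _ _ | inserted refl = ⊥-elim (insert≢b y≢a (trans eq insert-self))
      ... | before-b _ fy≡b _ | before-b _ fy′≡b _ = f-injective (trans fy≡b (sym fy′≡b))
      ... | before-b _ _ eq″ | unchanged′ y′≢a _ eq′ = ⊥-elim (f≢a y′≢a (trans (sym eq′) (trans (sym eq) eq″)))
      ... | unchanged′ y≢a _ eq″ | before-b _ _ eq′ = ⊥-elim (f≢a y≢a (trans (sym eq″) (trans eq eq′)))
      ... | unchanged′ _ _ eq″ | unchanged′ _ _ eq′ = f-injective (trans (sym eq″) (trans eq eq′))

      Reach-insert : ∀ {y w} → y ≢ a → Reach f y w → Reach (insert f a b) y w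
      Reach-insert y≢a y↝w = proj₁ (Reach-splice⁻ (λ ha≡a → b≢a (trans (sym insert-self) ha≡a)) y≢a
                                      (Reach-cong (λ d → sym (splice-insert d)) y↝w))

module _ {A : ℕ} {f : Dart A → Dart A} (f-injective : Injective _≡_ _≡_ f) where
  open Splicing (_≟ᴰ_ {A})
  private
    module F = DartPermutation f-injective

  module _ {z : Dart A} (fz≢z : f z ≢ z) where
    private
      g = splice f z
      g-injective = splice-injective {f = f} {z = z} f-injective
      module G = DartPermutation g-injective

    IsOrbitMin-splice-self : IsOrbitMin g z
    IsOrbitMin-splice-self (k , refl) = ℕₚ.≤-reflexive (cong dartRank (sym (iter-fixed k splice-self)))

    IsOrbitMin-splice⁻ : ∀ {y} → y ≢ z → IsOrbitMin f y → IsOrbitMin g y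
    IsOrbitMin-splice⁻ y≢z min y↝m = min (proj₁ (Reach-splice⁻ fz≢z y≢z y↝m))

    IsOrbitMin-splice⁺ : ∀ {y} → y ≢ z → IsOrbitMin g y → (Reach f y z → dartRank y ≤ dartRank z) → IsOrbitMin f y
    IsOrbitMin-splice⁺ y≢z min y≤z {m} y↝m with m ≟ᴰ z
    ... | yes refl = y≤z y↝m
    ... | no  m≢z  = min (Reach-splice⁺ f-injective y≢z y↝m m≢z)

    -- If z is not the minimum of its cycle it becomes a new one-element cycle with minimum z; otherwise
    -- the cycle of f z, which has lost z, acquires a new minimum.
    private
      count-splice-nonMin : ¬ T (isOrbitMinᵇ f z) → orbitCount g ≡ suc (orbitCount f)
      count-splice-nonMin ¬min-z = count-suc z (IsOrbitMin⇒isOrbitMinᵇ IsOrbitMin-splice-self) ¬min-z agree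
        where
        smaller = ¬isOrbitMinᵇ⇒smaller ¬min-z
        m = proj₁ smaller
        z↝m = proj₁ (proj₂ smaller)
        m<z = proj₂ (proj₂ smaller)
        m≢z : m ≢ z
        m≢z m≡z = ℕₚ.<-irrefl (cong dartRank m≡z) m<z
        agree : ∀ y → y ≢ z → isOrbitMinᵇ g y ≡ isOrbitMinᵇ f y
        agree y y≢z = isOrbitMinᵇ-cong g-injective f-injective y
          (λ min → IsOrbitMin-splice⁺ y≢z min (λ y↝z →
            ℕₚ.≤-trans (min (Reach-splice⁺ f-injective y≢z (Reach-trans y↝z z↝m) m≢z)) (ℕₚ.<⇒≤ m<z)))
          (IsOrbitMin-splice⁻ y≢z)

      count-splice-min : T (isOrbitMinᵇ f z) → orbitCount g ≡ suc (orbitCount f)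
      count-splice-min min-z = count-suc m (IsOrbitMin⇒isOrbitMinᵇ min-m) ¬min-m agree
        where
        new = orbitMin-exists g-injective (f z)
        m = proj₁ new
        fz↝m = proj₁ (proj₂ new)
        min-m = proj₂ (proj₂ new)
        fz↝ᶠm = proj₁ (Reach-splice⁻ fz≢z fz≢z fz↝m)
        m≢z = proj₂ (Reach-splice⁻ fz≢z fz≢z fz↝m)
        ¬min-m : ¬ T (isOrbitMinᵇ f m)
        ¬min-m t = m≢z (sym (orbitMin-unique f-injective (isOrbitMinᵇ⇒IsOrbitMin f-injective min-z)
                     (isOrbitMinᵇ⇒IsOrbitMin f-injective t) (Reach-trans Reach-step fz↝ᶠm)))
        agree′ : ∀ y → Dec (y ≡ z) → y ≢ m → isOrbitMinᵇ g y ≡ isOrbitMinᵇ f y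
        agree′ y (yes refl) _ = isOrbitMinᵇ-cong g-injective f-injective y
          (λ _ → isOrbitMinᵇ⇒IsOrbitMin f-injective min-z) (λ _ → IsOrbitMin-splice-self)
        agree′ y (no y≢z) y≢m = isOrbitMinᵇ-cong g-injective f-injective y
          (λ min → IsOrbitMin-splice⁺ y≢z min (λ y↝z → ⊥-elim (y≢m (orbitMin-unique g-injective min min-m
            (Reach-trans (G.Reach-sym (Reach-splice⁺ f-injective fz≢z
              (Reach-unstep (λ z≡y → y≢z (sym z≡y)) (F.Reach-sym y↝z)) y≢z)) fz↝m)))))
          (IsOrbitMin-splice⁻ y≢z)
        agree : ∀ y → y ≢ m → isOrbitMinᵇ g y ≡ isOrbitMinᵇ f y
        agree y = agree′ y (y ≟ᴰ z)

      count-splice : Dec (T (isOrbitMinᵇ f z)) → orbitCount g ≡ suc (orbitCount f)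
      count-splice (yes min-z) = count-splice-min min-z
      count-splice (no ¬min-z) = count-splice-nonMin ¬min-z

    orbitCount-splice : orbitCount g ≡ suc (orbitCount f)
    orbitCount-splice = count-splice (T? (isOrbitMinᵇ f z))

module _ {A : ℕ} {f : Dart A → Dart A} (f-injective : Injective _≡_ _≡_ f) where
  open Splicing (_≟ᴰ_ {A})

  orbitCount-insert : ∀ {a b} → f a ≡ a → b ≢ a → orbitCount f ≡ suc (orbitCount (insert f a b))
  orbitCount-insert {a} {b} fa≡a b≢a = begin
    orbitCount f             ≡⟨ orbitCount-cong (λ y → sym (splice≗f y)) ⟩
    orbitCount (splice h a)  ≡⟨ orbitCount-splice h-injective {a} ha≢a ⟩
    suc (orbitCount h)       ∎
    where
    open ≡-Reasoning
    h = insert f a b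
    h-injective = insert-injective f-injective fa≡a b≢a
    splice≗f : splice h a ≗ f
    splice≗f = splice-insert f-injective fa≡a b≢a
    ha≢a : h a ≢ a
    ha≢a ha≡a = b≢a (trans (sym (insert-self {f = f} {a = a})) ha≡a)

module _ {A : ℕ} (i : Fin (suc A)) where

  punchInDart : Dart A → Dart (suc A)
  punchInDart (e , b) = punchIn i e , b

  punchInDart≢ : ∀ d → proj₁ (punchInDart d) ≢ i
  punchInDart≢ (e , b) = Finₚ.punchInᵢ≢i i e

  punchInDart-injective : Injective _≡_ _≡_ punchInDart
  punchInDart-injective {e , b} {e′ , b′} eq
    with Finₚ.punchIn-injective i e e′ (cong proj₁ eq) | cong proj₂ eq
  ... | refl | refl = refl

  punchOutDart : (d : Dart (suc A)) → proj₁ d ≢ i → Dart A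
  punchOutDart (e , b) e≢i = punchOut (e≢i ∘ sym) , b

  punchInDart-punchOutDart : ∀ d (d≢i : proj₁ d ≢ i) → punchInDart (punchOutDart d d≢i) ≡ d
  punchInDart-punchOutDart (e , b) d≢i = cong (_, b) (Finₚ.punchIn-punchOut _)

  dartRank-punchInDart-< : ∀ {x y} → dartRank x < dartRank y →
                           dartRank (punchInDart x) < dartRank (punchInDart y)
  dartRank-punchInDart-< {e , s} {e′ , t} x<y with ℕₚ.<-cmp (toℕ e) (toℕ e′)
  ... | tri< e<e′ _ _ = 2*+bit-< s t (ℕₚ.≤∧≢⇒< (Finₚ.punchIn-mono-≤ i e e′ (ℕₚ.<⇒≤ e<e′))
                          (λ eq → ℕₚ.<⇒≢ e<e′ (cong toℕ (Finₚ.punchIn-injective i e e′ (Finₚ.toℕ-injective eq)))))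
  ... | tri≈ _ e≡e′ _ rewrite Finₚ.toℕ-injective e≡e′ =
        ℕₚ.+-monoʳ-< (2 * toℕ (punchIn i e′)) (ℕₚ.+-cancelˡ-< (2 * toℕ e′) _ _ x<y)
  ... | tri> _ _ e′<e = ⊥-elim (ℕₚ.<-asym x<y (2*+bit-< t s e′<e))

  dartRank-punchInDart-≤ : ∀ {x y} → dartRank x ≤ dartRank y →
                           dartRank (punchInDart x) ≤ dartRank (punchInDart y)
  dartRank-punchInDart-≤ x≤y with ℕₚ.m≤n⇒m<n∨m≡n x≤y
  ... | inj₁ x<y = ℕₚ.<⇒≤ (dartRank-punchInDart-< x<y)
  ... | inj₂ x≡y = ℕₚ.≤-reflexive (cong (dartRank ∘ punchInDart) (dartRank-injective x≡y))

  dartRank-punchInDart-≤⁻ : ∀ {x y} → dartRank (punchInDart x) ≤ dartRank (punchInDart y) →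
                            dartRank x ≤ dartRank y
  dartRank-punchInDart-≤⁻ ιx≤ιy = ℕₚ.≮⇒≥ (λ y<x → ℕₚ.<⇒≱ (dartRank-punchInDart-< y<x) ιx≤ιy)

  FixesEdge : (Dart (suc A) → Dart (suc A)) → Set
  FixesEdge f = ∀ b → f (i , b) ≡ (i , b)

  module Restriction {f : Dart (suc A) → Dart (suc A)} (f-injective : Injective _≡_ _≡_ f)
                     (f-fixes : FixesEdge f) where

    avoids : ∀ d → proj₁ (f (punchInDart d)) ≢ i
    avoids d f[ιd]∈i = punchInDart≢ d (cong proj₁ (f-injective (trans f[ιd]≡ (sym (f-fixes b)))))
      where
      b = proj₂ (f (punchInDart d))
      f[ιd]≡ : f (punchInDart d) ≡ (i , b)
      f[ιd]≡ = cong (_, b) f[ιd]∈i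

    restrict : Dart A → Dart A
    restrict d = punchOutDart (f (punchInDart d)) (avoids d)

    punchInDart-restrict : ∀ d → punchInDart (restrict d) ≡ f (punchInDart d)
    punchInDart-restrict d = punchInDart-punchOutDart (f (punchInDart d)) (avoids d)

    restrict-injective : Injective _≡_ _≡_ restrict
    restrict-injective {d} {d′} eq = punchInDart-injective (f-injective (begin
      f (punchInDart d)        ≡⟨ sym (punchInDart-restrict d) ⟩
      punchInDart (restrict d)  ≡⟨ cong punchInDart eq ⟩
      punchInDart (restrict d′) ≡⟨ punchInDart-restrict d′ ⟩
      f (punchInDart d′)       ∎))
      where open ≡-Reasoning

    iter-restrict : ∀ k d → punchInDart (iter k restrict d) ≡ iter k f (punchInDart d)
    iter-restrict k = iter-commute k punchInDart punchInDart-restrict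

    Reach-restrict : ∀ {x y} → Reach f (punchInDart x) (punchInDart y) → Reach restrict x y
    Reach-restrict {x} (k , eq) = k , punchInDart-injective (trans (iter-restrict k x) eq)

    isOrbitMinᵇ-restrict : ∀ d → isOrbitMinᵇ f (punchInDart d) ≡ isOrbitMinᵇ restrict d
    isOrbitMinᵇ-restrict d = T-injective
      (IsOrbitMin⇒isOrbitMinᵇ ∘ to ∘ isOrbitMinᵇ⇒IsOrbitMin f-injective)
      (IsOrbitMin⇒isOrbitMinᵇ ∘ from ∘ isOrbitMinᵇ⇒IsOrbitMin restrict-injective)
      where
      to : IsOrbitMin f (punchInDart d) → IsOrbitMin restrict d
      to min (k , refl) = dartRank-punchInDart-≤⁻ (min (k , sym (iter-restrict k d)))
      from : IsOrbitMin restrict d → IsOrbitMin f (punchInDart d)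
      from min (k , refl) = subst (λ m → dartRank (punchInDart d) ≤ dartRank m) (iter-restrict k d)
                              (dartRank-punchInDart-≤ (min (k , refl)))

    -- The two darts of the deleted edge are fixed points, each the minimum of its own cycle.
    orbitCount-restrict : orbitCount f ≡ 2 + orbitCount restrict
    orbitCount-restrict = begin
      orbitCount f
        ≡⟨ count≡sum (isOrbitMinᵇ f) ⟩
      sum (edgeCount (isOrbitMinᵇ f))
        ≡⟨ sum-remove {i = i} (edgeCount (isOrbitMinᵇ f)) ⟩
      edgeCount (isOrbitMinᵇ f) i + sum (edgeCount (isOrbitMinᵇ f) ∘ punchIn i)
        ≡⟨ cong₂ _+_ (cong₂ _+_ (cong bit (fixed-min true)) (cong bit (fixed-min false)))
                     (sum-cong-≗ {x = edgeCount (isOrbitMinᵇ f) ∘ punchIn i} {y = edgeCount (isOrbitMinᵇ restrict)}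
                       (λ e → cong₂ _+_ (cong bit (isOrbitMinᵇ-restrict (e , true)))
                                        (cong bit (isOrbitMinᵇ-restrict (e , false))))) ⟩
      2 + sum (edgeCount (isOrbitMinᵇ restrict))
        ≡⟨ cong (2 +_) (sym (count≡sum (isOrbitMinᵇ restrict))) ⟩
      2 + orbitCount restrict ∎
      where
      open ≡-Reasoning
      fixed-min : ∀ b → isOrbitMinᵇ f (i , b) ≡ true
      fixed-min b = T-injective (λ _ → _) (λ _ → IsOrbitMin⇒isOrbitMinᵇ
        (λ { (k , refl) → ℕₚ.≤-reflexive (cong dartRank (sym (iter-fixed k (f-fixes b)))) }))

rev-involutive : ∀ {A} (d : Dart A) → rev (rev d) ≡ d
rev-involutive (e , true)  = refl
rev-involutive (e , false) = refl

rev≢ : ∀ {A} (d : Dart A) → rev d ≢ d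
rev≢ (e , true)  ()
rev≢ (e , false) ()

edge-darts : ∀ {A} (d x : Dart A) → proj₁ d ≡ proj₁ x → d ≡ x ⊎ d ≡ rev x
edge-darts (e , true)  (.e , true)  refl = inj₁ refl
edge-darts (e , false) (.e , false) refl = inj₁ refl
edge-darts (e , true)  (.e , false) refl = inj₂ refl
edge-darts (e , false) (.e , true)  refl = inj₂ refl

module _ {S : ℕ} (G : GenGraph S) where

  tail-rev : ∀ d → tail G (rev d) ≡ head G d
  tail-rev (e , true)  = refl
  tail-rev (e , false) = refl

  head-rev : ∀ d → head G (rev d) ≡ tail G d
  head-rev (e , true)  = refl
  head-rev (e , false) = refl

  tail-τ : ∀ P d → tail G (τ G P d) ≡ head G d
  tail-τ P d = trans (Polarization.σ-tail P (rev d)) (tail-rev d)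

  _++ʷ_ : ∀ {u v w} → Walk G u v → Walk G v w → Walk G u w
  stay       ++ʷ q = q
  step d p   ++ʷ q = step d (p ++ʷ q)

  Walk-closed : (U : Fin S → Set) → (∀ d → U (tail G d) → U (head G d)) → ∀ {u w} → Walk G u w → U u → U w
  Walk-closed U closed stay       Uu = Uu
  Walk-closed U closed (step d p) Uu = Walk-closed U closed p (closed d Uu)

third-vertex : ∀ {S} → 3 ≤ S → (p q : Fin S) → ∃[ w ] w ≢ p × w ≢ q
third-vertex {suc (suc (suc _))} _ p q with q ≟ p
... | yes refl = punchIn p zero , Finₚ.punchInᵢ≢i p zero , Finₚ.punchInᵢ≢i p zero
... | no  q≢p  = punchIn p (punchIn q′ zero) , Finₚ.punchInᵢ≢i p _ ,
                 λ w≡q → Finₚ.punchInᵢ≢i q′ zero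
                   (Finₚ.punchIn-injective p _ _ (trans w≡q (sym (Finₚ.punchIn-punchOut (q≢p ∘ sym)))))
  where
  q′ = punchOut (q≢p ∘ sym)
third-vertex {zero}             ()
third-vertex {suc zero}         (s≤s ())
third-vertex {suc (suc zero)}   (s≤s (s≤s ()))

-- A walk from p to a third vertex would have to leave {p, q}.
closedPair-absurd : ∀ {S} (G : GenGraph S) → Connected G → 3 ≤ S → ∀ p q →
                    (∀ d → tail G d ≡ p ⊎ tail G d ≡ q → head G d ≡ p ⊎ head G d ≡ q) → ⊥
closedPair-absurd G connected 3≤S p q closed with third-vertex 3≤S p q
... | w , w≢p , w≢q with Walk-closed G (λ v → v ≡ p ⊎ v ≡ q) closed (connected p w) (inj₁ refl)
...   | inj₁ w≡p = w≢p w≡p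
...   | inj₂ w≡q = w≢q w≡q

linksᵇ : ∀ {S} → Fin S × Fin S → Fin S → Fin S → Bool
linksᵇ (p , q) v w = (⌊ p ≟ v ⌋ ∧ ⌊ q ≟ w ⌋) ∨ (⌊ p ≟ w ⌋ ∧ ⌊ q ≟ v ⌋)

linksᵇ-swap : ∀ {S} (p q v w : Fin S) → linksᵇ (p , q) v w ≡ linksᵇ (q , p) v w
linksᵇ-swap p q v w = trans (Boolₚ.∨-comm (⌊ p ≟ v ⌋ ∧ ⌊ q ≟ w ⌋) _)
                            (cong₂ _∨_ (Boolₚ.∧-comm ⌊ p ≟ w ⌋ _) (Boolₚ.∧-comm ⌊ p ≟ v ⌋ _))

linksᵇ-loop : ∀ {S} {p v w : Fin S} → v ≢ w → ¬ T ((⌊ p ≟ v ⌋ ∧ ⌊ p ≟ w ⌋) ∨ (⌊ p ≟ w ⌋ ∧ ⌊ p ≟ v ⌋))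
linksᵇ-loop {p = p} {v} {w} v≢w with p ≟ v | p ≟ w
... | yes refl | yes refl = λ _ → v≢w refl
... | yes _    | no  _    = λ ()
... | no  _    | yes _    = λ ()
... | no  _    | no  _    = λ ()

module _ {S : ℕ} (G : GenGraph S) where
  open GenGraph G

  linksᵇ-dart : ∀ d v w → linksᵇ (ends (proj₁ d)) v w ≡ linksᵇ (tail G d , head G d) v w
  linksᵇ-dart (e , true)  v w = refl
  linksᵇ-dart (e , false) v w = linksᵇ-swap (proj₁ (ends e)) (proj₂ (ends e)) v w

  T-adjacentᵇ⁺ : ∀ {v w} e → T (linksᵇ (ends e) v w) → T (adjacentᵇ G v w)
  T-adjacentᵇ⁺ e t = Anyₚ.any⁺ _ (lose (∈-allFin e) t)

  T-adjacentᵇ⁻ : ∀ {v w} → T (adjacentᵇ G v w) → ∃[ e ] T (linksᵇ (ends e) v w)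
  T-adjacentᵇ⁻ t = Any.satisfied (Anyₚ.any⁻ _ (allFin A) t)

eulerGenus : ℕ → ℕ → ℕ → ℚ.ℚ
eulerGenus S A F = ℚ.1ℚ ℚ.- ((ℤ.+ S ℤ.- ℤ.+ A ℤ.+ ℤ.+ F) ℚ./ 2)

eulerGenus-suc : ∀ S A F → eulerGenus S (suc A) (suc F) ≡ eulerGenus S A F
eulerGenus-suc S A F = cong (λ z → ℚ.1ℚ ℚ.- (z ℚ./ 2)) (shift (ℤ.+ S) (ℤ.+ A) (ℤ.+ F))
  where
  shift : ∀ (s a f : ℤ.ℤ) → s ℤ.- (ℤ.1ℤ ℤ.+ a) ℤ.+ (ℤ.1ℤ ℤ.+ f) ≡ s ℤ.- a ℤ.+ f
  shift = solve-∀

graph : ∀ {S A} → (Fin A → Fin S × Fin S) → GenGraph S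
graph {A = A} ends = record { A = A ; ends = ends }

module EdgeDeletion {S A : ℕ} (ends : Fin (suc A) → Fin S × Fin S) (x : Dart (suc A)) where

  i : Fin (suc A)
  i = proj₁ x

  G G′ : GenGraph S
  G  = graph ends
  G′ = graph (ends ∘ punchIn i)

  ι : Dart A → Dart (suc A)
  ι = punchInDart i

  tail-ι : ∀ d → tail G′ d ≡ tail G (ι d)
  tail-ι (e , true)  = refl
  tail-ι (e , false) = refl

  head-ι : ∀ d → head G′ d ≡ head G (ι d)
  head-ι (e , true)  = refl
  head-ι (e , false) = refl

  ι≢x : ∀ d → ι d ≢ x
  ι≢x d = punchInDart≢ i d ∘ cong proj₁

  ι≢rev-x : ∀ d → ι d ≢ rev x
  ι≢rev-x d = punchInDart≢ i d ∘ cong proj₁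

  edgeRemoval : EdgeRemoval G′ G
  edgeRemoval = punchIn i , (λ {e} {e′} → Finₚ.punchIn-injective i e e′) , (λ e → refl)

  Redundant : Set
  Redundant = tail G x ≡ head G x ⊎ ∃[ d ] tail G′ d ≡ tail G x × head G′ d ≡ head G x

  module _ (redundant : Redundant) where

    private
      edgeWalk : ∀ {u v} d → tail G′ d ≡ u → head G′ d ≡ v → Walk G′ u v
      edgeWalk d refl refl = step d stay

      parallelWalk : Redundant → Walk G′ (tail G x) (head G x)
      parallelWalk (inj₁ loop)          = subst (Walk G′ _) loop stay
      parallelWalk (inj₂ (d , td , hd)) = edgeWalk d td hd

      parallelWalk⁻ : Redundant → Walk G′ (head G x) (tail G x)
      parallelWalk⁻ (inj₁ loop)          = subst (Walk G′ _) (sym loop) stay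
      parallelWalk⁻ (inj₂ (d , td , hd)) = edgeWalk (rev d) (trans (tail-rev G′ d) hd) (trans (head-rev G′ d) td)

      bypass : ∀ d → Walk G′ (tail G d) (head G d)
      bypass d with proj₁ d ≟ i
      ... | no d∉i = edgeWalk (punchOutDart i d d∉i)
                       (trans (tail-ι (punchOutDart i d d∉i)) (cong (tail G) (punchInDart-punchOutDart i d d∉i)))
                       (trans (head-ι (punchOutDart i d d∉i)) (cong (head G) (punchInDart-punchOutDart i d d∉i)))
      ... | yes d∈i with edge-darts d x d∈i
      ...   | inj₁ refl = parallelWalk redundant
      ...   | inj₂ refl = subst₂ (Walk G′) (sym (tail-rev G x)) (sym (head-rev G x)) (parallelWalk⁻ redundant)

      translate : ∀ {u v} → Walk G u v → Walk G′ u v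
      translate stay       = stay
      translate (step d p) = _++ʷ_ G′ (bypass d) (translate p)

    connected-deleteEdge : Connected G → Connected G′
    connected-deleteEdge connected u v = translate (connected u v)

    adjacentᵇ-deleteEdge : ∀ {v w} → v ≢ w → adjacentᵇ G′ v w ≡ adjacentᵇ G v w
    adjacentᵇ-deleteEdge {v} {w} v≢w = T-injective to from
      where
      to : T (adjacentᵇ G′ v w) → T (adjacentᵇ G v w)
      to t = let e , l = T-adjacentᵇ⁻ G′ t in T-adjacentᵇ⁺ G (punchIn i e) l
      from : T (adjacentᵇ G v w) → T (adjacentᵇ G′ v w)
      from t with T-adjacentᵇ⁻ G t
      ... | e , l with e ≟ i
      ...   | no e≢i = T-adjacentᵇ⁺ G′ (punchOut (e≢i ∘ sym))
                         (subst (λ e → T (linksᵇ (ends e) v w)) (sym (Finₚ.punchIn-punchOut (e≢i ∘ sym))) l)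
      ...   | yes refl = via redundant (subst T (linksᵇ-dart G x v w) l)
        where
        via : Redundant → T (linksᵇ (tail G x , head G x) v w) → T (adjacentᵇ G′ v w)
        via (inj₁ loop) l = ⊥-elim (linksᵇ-loop {p = head G x} v≢w (subst (λ p → T (linksᵇ (p , head G x) v w)) loop l))
        via (inj₂ (d , td , hd)) l = T-adjacentᵇ⁺ G′ (proj₁ d)
          (subst T (sym (trans (linksᵇ-dart G′ d v w) (cong₂ (λ p q → linksᵇ (p , q) v w) td hd))) l)

    reducedValence-deleteEdge : ∀ v → reducedValence G′ v ≡ reducedValence G v
    reducedValence-deleteEdge v =
      cong length (Listₚ.filter-≐ (T? ∘ p′) (T? ∘ p)
        ((λ {w} → subst T (p′≗p w)) , (λ {w} → subst T (sym (p′≗p w)))) (allFin S))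
      where
      p′ p : Fin S → Bool
      p′ w = not ⌊ w ≟ v ⌋ ∧ adjacentᵇ G′ v w
      p  w = not ⌊ w ≟ v ⌋ ∧ adjacentᵇ G v w
      p′≗p : ∀ w → p′ w ≡ p w
      p′≗p w with w ≟ v
      ... | yes _   = refl
      ... | no  w≢v = adjacentᵇ-deleteEdge (w≢v ∘ sym)

  module _ (P : Polarization G) where
    open Splicing (_≟ᴰ_ {suc A})
    open Polarization P using (σ; σ⁻¹; σ⁻¹σ)

    σ-injective : Injective _≡_ _≡_ σ
    σ-injective {d} {d′} eq = trans (sym (σ⁻¹σ d)) (trans (cong σ⁻¹ eq) (σ⁻¹σ d′))

    τ-injective : Injective _≡_ _≡_ (τ G P)
    τ-injective {d} {d′} eq = trans (sym (rev-involutive d)) (trans (cong rev (σ-injective eq)) (rev-involutive d′))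

    σ∖x : Dart (suc A) → Dart (suc A)
    σ∖x = splice (splice σ (rev x)) x

    σ∖x-injective : Injective _≡_ _≡_ σ∖x
    σ∖x-injective = splice-injective (splice-injective σ-injective)

    σ∖x-fixes : FixesEdge i σ∖x
    σ∖x-fixes b with edge-darts (i , b) x refl
    ... | inj₁ eq = subst (λ d → σ∖x d ≡ d) (sym eq) splice-self
    ... | inj₂ eq = subst (λ d → σ∖x d ≡ d) (sym eq)
                      (trans (splice-other (rev≢ x) (λ e → rev≢ x (trans (sym splice-self) e))) splice-self)

    private
      module R = Restriction i σ∖x-injective σ∖x-fixes
      module R⁻¹ = DartPermutation R.restrict-injective

    deletePolarization : Polarization G′
    deletePolarization = record
      { σ        = R.restrict
      ; σ⁻¹      = R⁻¹.inverse
      ; σσ⁻¹     = R⁻¹.f∘inverse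
      ; σ⁻¹σ     = R⁻¹.inverse∘f
      ; σ-tail   = λ d → begin
          tail G′ (R.restrict d)       ≡⟨ tail-ι (R.restrict d) ⟩
          tail G (ι (R.restrict d))    ≡⟨ cong (tail G) (R.punchInDart-restrict d) ⟩
          tail G (σ∖x (ι d))           ≡⟨ splice-preserves (tail G)
                                            (splice-preserves (tail G) (Polarization.σ-tail P)) (ι d) ⟩
          tail G (ι d)                 ≡⟨ sym (tail-ι d) ⟩
          tail G′ d                    ∎
      ; σ-cyclic = λ d d′ td≡td′ → R.Reach-restrict
          (Reach-splice⁺ (splice-injective σ-injective) (ι≢x d)
            (Reach-splice⁺ σ-injective (ι≢rev-x d)
              (Polarization.σ-cyclic P (ι d) (ι d′) (trans (sym (tail-ι d)) (trans td≡td′ (tail-ι d′))))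
              (ι≢rev-x d′))
            (ι≢x d′))
      }
      where open ≡-Reasoning

    private
      P′ = deletePolarization

    -- τc is the left-walk permutation of G′ transported to G, with both darts of the deleted edge fixed.
    module LeftWalksAfterDeletion {τc : Dart (suc A) → Dart (suc A)} (τc-injective : Injective _≡_ _≡_ τc)
                                  (τc-fixes : FixesEdge i τc) (τc-agrees : ∀ d → τc (ι d) ≡ σ∖x (rev (ι d))) where

      private
        module C = Restriction i τc-injective τc-fixes

      τ′≗restrict : τ G′ P′ ≗ C.restrict
      τ′≗restrict d = punchInDart-injective i (begin
        ι (R.restrict (rev d))  ≡⟨ R.punchInDart-restrict (rev d) ⟩
        σ∖x (ι (rev d))         ≡⟨ sym (τc-agrees d) ⟩
        τc (ι d)                ≡⟨ sym (C.punchInDart-restrict d) ⟩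
        ι (C.restrict d)        ∎)
        where open ≡-Reasoning

      genus-deleteEdge : orbitCount τc ≡ suc (numLeftWalks G P) → genus G′ P′ ≡ genus G P
      genus-deleteEdge count≡ = begin
        eulerGenus S A (numLeftWalks G′ P′)               ≡⟨ sym (eulerGenus-suc S A _) ⟩
        eulerGenus S (suc A) (suc (numLeftWalks G′ P′))   ≡⟨ cong (eulerGenus S (suc A)) (sym F≡1+F′) ⟩
        eulerGenus S (suc A) (numLeftWalks G P)           ∎
        where
        open ≡-Reasoning
        F≡1+F′ : numLeftWalks G P ≡ suc (numLeftWalks G′ P′)
        F≡1+F′ = ℕₚ.suc-injective (begin
          suc (numLeftWalks G P)              ≡⟨ sym count≡ ⟩
          orbitCount τc                       ≡⟨ C.orbitCount-restrict ⟩
          suc (suc (orbitCount C.restrict))   ≡⟨ cong (2 +_) (orbitCount-cong (λ d → sym (τ′≗restrict d))) ⟩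
          suc (suc (numLeftWalks G′ P′))      ∎)

      complete-deleteEdge : (s : Dart A) → (∀ y → Reach (τ G P) (rev x) (ι y) → Reach τc (ι s) (ι y)) →
                            (d₀ : Dart (suc A)) → Reach (τ G P) d₀ (rev x) →
                            (∀ e → ∃[ k ] proj₁ (iter k (τ G P) d₀) ≡ e) → HasCompleteLeftWalk G′ P′
      complete-deleteEdge s s↝ d₀ d₀↝rev-x covers = s , λ e′ → covered e′ (covers (punchIn i e′))
        where
        covered : ∀ e′ → ∃[ k ] proj₁ (iter k (τ G P) d₀) ≡ punchIn i e′ →
                  ∃[ k ] proj₁ (iter k (τ G′ P′) s) ≡ e′
        covered e′ (k , at-e′) = proj₁ s↝y′ , Finₚ.punchIn-injective i _ _ (begin
            punchIn i (proj₁ (iter (proj₁ s↝y′) (τ G′ P′) s))  ≡⟨ cong (proj₁ ∘ ι) (proj₂ s↝y′) ⟩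
            proj₁ (ι y′)                                      ≡⟨ cong proj₁ (punchInDart-punchOutDart i y y∉i) ⟩
            proj₁ y                                           ≡⟨ at-e′ ⟩
            punchIn i e′                                      ∎)
          where
          open ≡-Reasoning
          y = iter k (τ G P) d₀
          y∉i : proj₁ y ≢ i
          y∉i y∈i = Finₚ.punchInᵢ≢i i e′ (trans (sym at-e′) y∈i)
          y′ = punchOutDart i y y∉i
          rev-x↝y : Reach (τ G P) (rev x) (ι y′)
          rev-x↝y = Reach-trans (DartPermutation.Reach-sym τ-injective d₀↝rev-x)
                                (k , sym (punchInDart-punchOutDart i y y∉i))
          s↝y′ : Reach (τ G′ P′) s y′
          s↝y′ = Reach-cong (λ d → sym (τ′≗restrict d)) (C.Reach-restrict (s↝ y′ rev-x↝y))

module LeftWalkOfLength1 {S A : ℕ} (ends : Fin (suc A) → Fin S × Fin S) (x : Dart (suc A))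
                         (connected : Connected (graph ends)) (3≤S : 3 ≤ S) (P : Polarization (graph ends))
                         (τx≡x : τ (graph ends) P x ≡ x) where
  open EdgeDeletion ends x
  open Splicing (_≟ᴰ_ {suc A})

  private
    σ = Polarization.σ P
    τᴳ = τ G P

  loop : tail G x ≡ head G x
  loop = trans (cong (tail G) (sym τx≡x)) (tail-τ G P x)

  onlyLoop-absurd : (∀ d → tail G d ≡ tail G x → d ≡ x ⊎ d ≡ rev x) → ⊥
  onlyLoop-absurd only = closedPair-absurd G connected 3≤S (tail G x) (tail G x) closed
    where
    closed : ∀ d → tail G d ≡ tail G x ⊎ tail G d ≡ tail G x → head G d ≡ tail G x ⊎ head G d ≡ tail G x
    closed d (inj₁ at-x) with only d at-x
    ... | inj₁ refl = inj₁ (sym loop)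
    ... | inj₂ refl = inj₁ (head-rev G x)
    closed d (inj₂ at-x) = closed d (inj₁ at-x)

  -- Otherwise the loop would be the only edge at its vertex.
  σx≢rev-x : σ x ≢ rev x
  σx≢rev-x σx≡rev-x = onlyLoop-absurd λ d td≡tx →
    Reach-2-cycle σx≡rev-x τx≡x (Polarization.σ-cyclic P x d (sym td≡tx))

  τ-rev-x≡σx : τᴳ (rev x) ≡ σ x
  τ-rev-x≡σx = cong σ (rev-involutive x)

  τ-rev-x≢rev-x : τᴳ (rev x) ≢ rev x
  τ-rev-x≢rev-x = σx≢rev-x ∘ trans (sym τ-rev-x≡σx)

  τc : Dart (suc A) → Dart (suc A)
  τc = splice τᴳ (rev x)

  τc-fixes : FixesEdge i τc
  τc-fixes b with edge-darts (i , b) x refl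
  ... | inj₁ refl = trans (splice-other (rev≢ x ∘ sym) (rev≢ x ∘ sym ∘ trans (sym τx≡x))) τx≡x
  ... | inj₂ refl = splice-self

  τc-agrees : ∀ d → τc (ι d) ≡ σ∖x P (rev (ι d))
  τc-agrees d with spliceView τᴳ (rev x) (ι d)
  ... | spliced y≡rev-x = ⊥-elim (ι≢rev-x d y≡rev-x)
  ... | predecessor _ τy≡rev-x τc-y = begin
    τc (ι d)                                  ≡⟨ τc-y ⟩
    τᴳ (rev x)                                ≡⟨ τ-rev-x≡σx ⟩
    σ x                                       ≡⟨ sym (splice-other (rev≢ x ∘ sym) σx≢rev-x) ⟩
    splice σ (rev x) x                        ≡⟨ sym (splice-pred (ι≢x (rev d))
                                                   (trans (splice-pred (ι≢rev-x (rev d)) τy≡rev-x) τx≡x)) ⟩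
    σ∖x P (rev (ι d))                         ∎
    where open ≡-Reasoning
  ... | unchanged _ τy≢rev-x τc-y = begin
    τc (ι d)                                  ≡⟨ τc-y ⟩
    τᴳ (ι d)                                  ≡⟨ sym inner ⟩
    splice σ (rev x) (rev (ι d))              ≡⟨ sym (splice-other (ι≢x (rev d))
                                                   (λ eq → ι≢x d (τ-injective P (trans (trans (sym inner) eq) (sym τx≡x))))) ⟩
    σ∖x P (rev (ι d))                         ∎
    where
    open ≡-Reasoning
    inner : splice σ (rev x) (rev (ι d)) ≡ τᴳ (ι d)
    inner = splice-other (ι≢rev-x (rev d)) τy≢rev-x

  orbitCount-τc : orbitCount τc ≡ suc (numLeftWalks G P)
  orbitCount-τc = orbitCount-splice (τ-injective P) τ-rev-x≢rev-x

  open LeftWalksAfterDeletion P (splice-injective (τ-injective P)) τc-fixes τc-agrees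

  redundant : Redundant
  redundant = inj₁ loop

  genus-preserved : genus G′ (deletePolarization P) ≡ genus G P
  genus-preserved = genus-deleteEdge orbitCount-τc

  complete′ : HasCompleteLeftWalk G P → HasCompleteLeftWalk G′ (deletePolarization P)
  complete′ (d₀ , covers) = complete-deleteEdge s s↝ d₀ d₀↝rev-x covers
    where
    a = τᴳ (rev x)
    a∉i : proj₁ a ≢ i
    a∉i a∈i with edge-darts a x a∈i
    ... | inj₁ a≡x   = rev≢ x (τ-injective P (trans a≡x (sym τx≡x)))
    ... | inj₂ a≡rev = τ-rev-x≢rev-x a≡rev
    s = punchOutDart i a a∉i
    s↝ : ∀ y → Reach τᴳ (rev x) (ι y) → Reach τc (ι s) (ι y)
    s↝ y rev-x↝y = subst (λ d → Reach τc d (ι y)) (sym (punchInDart-punchOutDart i a a∉i))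
      (Reach-splice⁺ (τ-injective P) τ-rev-x≢rev-x (Reach-unstep (ι≢rev-x y ∘ sym) rev-x↝y) (ι≢rev-x y))
    d₀↝rev-x : Reach τᴳ d₀ (rev x)
    d₀↝rev-x with covers i
    ... | k , at-i with edge-darts (iter k τᴳ d₀) x at-i
    ...   | inj₂ eq = k , eq
    ...   | inj₁ eq = ⊥-elim (onlyLoop-absurd (λ d _ → edge-darts d x (edge-is-i d)))
      where
      d₀≡x : d₀ ≡ x
      d₀≡x = Reach-fixed τx≡x (DartPermutation.Reach-sym (τ-injective P) (k , eq))
      edge-is-i : ∀ d → proj₁ d ≡ i
      edge-is-i d with covers (proj₁ d)
      ... | m , at-d = trans (sym at-d) (cong proj₁ (Reach-fixed τx≡x (m , cong (iter m τᴳ) (sym d₀≡x))))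

module LeftWalkOfLength2 {S A : ℕ} (ends : Fin (suc A) → Fin S × Fin S) (x : Dart (suc A))
                         (connected : Connected (graph ends)) (3≤S : 3 ≤ S) (P : Polarization (graph ends))
                         (no-fixed : ∀ d → τ (graph ends) P d ≢ d)
                         (ττx≡x : τ (graph ends) P (τ (graph ends) P x) ≡ x) where
  open EdgeDeletion ends x
  open Splicing (_≟ᴰ_ {suc A})

  private
    σ = Polarization.σ P
    τᴳ = τ G P
    τ-injective′ = τ-injective P

  d₂ : Dart (suc A)
  d₂ = τᴳ x

  tail-d₂ : tail G d₂ ≡ head G x
  tail-d₂ = tail-τ G P x

  head-d₂ : head G d₂ ≡ tail G x
  head-d₂ = trans (sym (tail-τ G P d₂)) (cong (tail G) ττx≡x)

  τ-rev-x≡σx : τᴳ (rev x) ≡ σ x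
  τ-rev-x≡σx = cong σ (rev-involutive x)

  -- Otherwise σ fixes both darts of the edge and its two ends form a closed pair.
  d₂≢rev-x : d₂ ≢ rev x
  d₂≢rev-x d₂≡rev-x = closedPair-absurd G connected 3≤S (tail G x) (head G x) closed
    where
    σx≡x : σ x ≡ x
    σx≡x = trans (sym τ-rev-x≡σx) (trans (cong τᴳ (sym d₂≡rev-x)) ττx≡x)
    closed : ∀ d → tail G d ≡ tail G x ⊎ tail G d ≡ head G x → head G d ≡ tail G x ⊎ head G d ≡ head G x
    closed d (inj₁ at-tail) with Reach-fixed σx≡x (Polarization.σ-cyclic P x d (sym at-tail))
    ... | refl = inj₂ refl
    closed d (inj₂ at-head)
      with Reach-fixed d₂≡rev-x (Polarization.σ-cyclic P (rev x) d (trans (tail-rev G x) (sym at-head)))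
    ... | refl = inj₁ (head-rev G x)

  d₂∉i : proj₁ d₂ ≢ i
  d₂∉i d₂∈i with edge-darts d₂ x d₂∈i
  ... | inj₁ d₂≡x   = no-fixed x d₂≡x
  ... | inj₂ d₂≡rev = d₂≢rev-x d₂≡rev

  redundant : Redundant
  redundant = inj₂ (d₂′ ,
    trans (tail-ι d₂′) (trans (cong (tail G) ιd₂′≡rev-d₂) (trans (tail-rev G d₂) head-d₂)) ,
    trans (head-ι d₂′) (trans (cong (head G) ιd₂′≡rev-d₂) (trans (head-rev G d₂) tail-d₂)))
    where
    d₂′ = punchOutDart i (rev d₂) d₂∉i
    ιd₂′≡rev-d₂ = punchInDart-punchOutDart i (rev d₂) d₂∉i

  -- d₂ takes over the place of rev x in its left walk; x and rev x become fixed points.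
  τ₁ τ₂ τc : Dart (suc A) → Dart (suc A)
  τ₁ = splice τᴳ x
  τ₂ = insert τ₁ d₂ (rev x)
  τc = splice τ₂ (rev x)

  private
    rev-x≢d₂ : rev x ≢ d₂
    rev-x≢d₂ = d₂≢rev-x ∘ sym

    τ₁-injective : Injective _≡_ _≡_ τ₁
    τ₁-injective = splice-injective τ-injective′

    τ₁d₂≡d₂ : τ₁ d₂ ≡ d₂
    τ₁d₂≡d₂ = splice-pred {f = τᴳ} (no-fixed x) ττx≡x

    τ₂-injective : Injective _≡_ _≡_ τ₂
    τ₂-injective = insert-injective τ₁-injective τ₁d₂≡d₂ rev-x≢d₂

    τ-rev-x≢x : τᴳ (rev x) ≢ x
    τ-rev-x≢x eq = rev-x≢d₂ (τ-injective′ (trans eq (sym ττx≡x)))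

    τ₂-rev-x : τ₂ (rev x) ≡ τᴳ (rev x)
    τ₂-rev-x = trans (insert-other rev-x≢d₂ (no-fixed (rev x) ∘ trans (sym τ₁-rev-x))) τ₁-rev-x
      where
      τ₁-rev-x : τ₁ (rev x) ≡ τᴳ (rev x)
      τ₁-rev-x = splice-other {f = τᴳ} (rev≢ x) τ-rev-x≢x

    τ₂x≡x : τ₂ x ≡ x
    τ₂x≡x = trans (insert-other (no-fixed x ∘ sym) (rev≢ x ∘ sym ∘ trans (sym τ₁x≡x))) τ₁x≡x
      where
      τ₁x≡x : τ₁ x ≡ x
      τ₁x≡x = splice-self

  τc-fixes : FixesEdge i τc
  τc-fixes b with edge-darts (i , b) x refl
  ... | inj₁ refl = trans (splice-other (rev≢ x ∘ sym) (rev≢ x ∘ sym ∘ trans (sym τ₂x≡x))) τ₂x≡x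
  ... | inj₂ refl = splice-self

  orbitCount-τc : orbitCount τc ≡ suc (numLeftWalks G P)
  orbitCount-τc = begin
    orbitCount τc          ≡⟨ orbitCount-splice τ₂-injective {rev x} (no-fixed (rev x) ∘ trans (sym τ₂-rev-x)) ⟩
    suc (orbitCount τ₂)    ≡⟨ sym (orbitCount-insert τ₁-injective τ₁d₂≡d₂ rev-x≢d₂) ⟩
    orbitCount τ₁          ≡⟨ orbitCount-splice τ-injective′ (no-fixed x) ⟩
    suc (orbitCount τᴳ)    ∎
    where open ≡-Reasoning

  τc-agrees : ∀ d → τc (ι d) ≡ σ∖x P (rev (ι d))
  τc-agrees d with spliceView τᴳ x (ι d)
  ... | spliced y≡x = ⊥-elim (ι≢x d y≡x)
  ... | predecessor _ τy≡x _ with τ-injective′ (trans τy≡x (sym ττx≡x))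
  ...   | y≡d₂ = begin
    τc (ι d)                      ≡⟨ cong τc y≡d₂ ⟩
    τc d₂                         ≡⟨ splice-pred d₂≢rev-x (insert-self {f = τ₁} {a = d₂}) ⟩
    τ₂ (rev x)                    ≡⟨ τ₂-rev-x ⟩
    τᴳ (rev x)                    ≡⟨ τ-rev-x≡σx ⟩
    σ x                           ≡⟨ sym (splice-other (rev≢ x ∘ sym) (no-fixed (rev x) ∘ trans τ-rev-x≡σx)) ⟩
    splice σ (rev x) x            ≡⟨ sym (splice-pred (ι≢x (rev d)) (trans (splice-other (ι≢rev-x (rev d))
                                       (rev≢ x ∘ sym ∘ trans (sym τy≡x))) τy≡x)) ⟩
    σ∖x P (rev (ι d))             ∎
    where open ≡-Reasoning
  τc-agrees d | unchanged _ τy≢x τ₁y≡τy with τᴳ (ι d) ≟ᴰ rev x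
  ... | yes τy≡rev-x = begin
    τc (ι d)                      ≡⟨ splice-other (ι≢rev-x d) (d₂≢rev-x ∘ trans (sym τ₂y≡d₂)) ⟩
    τ₂ (ι d)                      ≡⟨ τ₂y≡d₂ ⟩
    d₂                            ≡⟨ sym inner ⟩
    splice σ (rev x) (rev (ι d))  ≡⟨ sym (splice-other (ι≢x (rev d)) (no-fixed x ∘ trans (sym inner))) ⟩
    σ∖x P (rev (ι d))             ∎
    where
    open ≡-Reasoning
    τ₂y≡d₂ : τ₂ (ι d) ≡ d₂
    τ₂y≡d₂ = insert-pred (λ y≡d₂ → τy≢x (trans (cong τᴳ y≡d₂) ττx≡x)) (trans τ₁y≡τy τy≡rev-x)
    inner : splice σ (rev x) (rev (ι d)) ≡ d₂
    inner = splice-pred (ι≢rev-x (rev d)) τy≡rev-x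
  ... | no τy≢rev-x = begin
    τc (ι d)                      ≡⟨ splice-other (ι≢rev-x d) (τy≢rev-x ∘ trans (sym τ₂y≡τy)) ⟩
    τ₂ (ι d)                      ≡⟨ τ₂y≡τy ⟩
    τᴳ (ι d)                      ≡⟨ sym inner ⟩
    splice σ (rev x) (rev (ι d))  ≡⟨ sym (splice-other (ι≢x (rev d)) (τy≢x ∘ trans (sym inner))) ⟩
    σ∖x P (rev (ι d))             ∎
    where
    open ≡-Reasoning
    τ₂y≡τy : τ₂ (ι d) ≡ τᴳ (ι d)
    τ₂y≡τy = trans (insert-other (λ y≡d₂ → τy≢x (trans (cong τᴳ y≡d₂) ττx≡x)) (τy≢rev-x ∘ trans (sym τ₁y≡τy)))
                   τ₁y≡τy
    inner : splice σ (rev x) (rev (ι d)) ≡ τᴳ (ι d)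
    inner = splice-other (ι≢rev-x (rev d)) τy≢rev-x

  open LeftWalksAfterDeletion P (splice-injective τ₂-injective) τc-fixes τc-agrees

  genus-preserved : genus G′ (deletePolarization P) ≡ genus G P
  genus-preserved = genus-deleteEdge orbitCount-τc

  complete′ : HasCompleteLeftWalk G P → HasCompleteLeftWalk G′ (deletePolarization P)
  complete′ (d₀ , covers) = complete-deleteEdge (punchOutDart i d₂ d₂∉i) s↝ d₀ d₀↝rev-x covers
    where
    s↝ : ∀ y → Reach τᴳ (rev x) (ι y) → Reach τc (ι (punchOutDart i d₂ d₂∉i)) (ι y)
    s↝ y rev-x↝y = subst (λ d → Reach τc d (ι y)) (sym (punchInDart-punchOutDart i d₂ d₂∉i))
      (Reach-splice⁺ τ₂-injective d₂≢rev-x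
        (Reach-trans (1 , insert-self {f = τ₁} {a = d₂})
          (Reach-insert τ₁-injective τ₁d₂≡d₂ rev-x≢d₂ rev-x≢d₂
            (Reach-splice⁺ τ-injective′ (rev≢ x) rev-x↝y (ι≢x y))))
        (ι≢rev-x y))
    d₀↝rev-x : Reach τᴳ d₀ (rev x)
    d₀↝rev-x with covers i
    ... | k , at-i with edge-darts (iter k τᴳ d₀) x at-i
    ...   | inj₂ eq = k , eq
    ...   | inj₁ eq = ⊥-elim (closedPair-absurd G connected 3≤S (tail G x) (head G x) (λ d _ → heads d))
      where
      -- The complete left walk would be (x d₂), so every edge is that of x or of d₂.
      x↝d₀ : Reach τᴳ x d₀
      x↝d₀ = DartPermutation.Reach-sym τ-injective′ (k , eq)
      edges : ∀ e → e ≡ i ⊎ e ≡ proj₁ d₂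
      edges e with covers e
      ... | m , at-e with Reach-2-cycle refl ττx≡x (Reach-trans x↝d₀ (m , refl))
      ...   | inj₁ on-x  = inj₁ (trans (sym at-e) (cong proj₁ on-x))
      ...   | inj₂ on-d₂ = inj₂ (trans (sym at-e) (cong proj₁ on-d₂))
      heads : ∀ d → head G d ≡ tail G x ⊎ head G d ≡ head G x
      heads d with edges (proj₁ d)
      ... | inj₁ d∈i with edge-darts d x d∈i
      ...   | inj₁ refl = inj₂ refl
      ...   | inj₂ refl = inj₁ (head-rev G x)
      heads d | inj₂ d∈d₂ with edge-darts d d₂ d∈d₂
      ...   | inj₁ refl = inj₁ head-d₂
      ...   | inj₂ refl = inj₂ (trans (head-rev G d₂) tail-d₂)

any-dart? : ∀ {A} {Q : Dart A → Set} → (∀ d → Dec (Q d)) → Dec (∃ Q)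
any-dart? {Q = Q} Q? = map′ to from (Finₚ.any? λ e → Q? (e , true) ⊎-dec Q? (e , false))
  where
  to : ∃ (λ e → Q (e , true) ⊎ Q (e , false)) → ∃ Q
  to (e , inj₁ q) = (e , true) , q
  to (e , inj₂ q) = (e , false) , q
  from : ∃ Q → ∃ (λ e → Q (e , true) ⊎ Q (e , false))
  from ((e , true)  , q) = e , inj₁ q
  from ((e , false) , q) = e , inj₂ q

record Reduction {S} (G : GenGraph S) (P : Polarization G) : Set where
  constructor reduction
  field
    G′        : GenGraph S
    connected : Connected G′
    P′        : Polarization G′
    complete  : HasCompleteLeftWalk G′ P′
    short     : NoLeftWalkOfLength1or2 G′ P′
    removal   : EdgeRemoval G′ G
    genus-≡   : genus G′ P′ ≡ genus G P
    valence-≡ : ∀ v → reducedValence G′ v ≡ reducedValence G v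

EdgeRemoval-trans : ∀ {S} {G₂ G₁ G : GenGraph S} → EdgeRemoval G₂ G₁ → EdgeRemoval G₁ G → EdgeRemoval G₂ G
EdgeRemoval-trans (ι₂ , ι₂-injective , ends₂) (ι₁ , ι₁-injective , ends₁) =
  ι₁ ∘ ι₂ , ι₂-injective ∘ ι₁-injective , λ e → trans (ends₂ e) (ends₁ (ι₂ e))

Reduction-refl : ∀ {S} {G : GenGraph S} {P} → Connected G → HasCompleteLeftWalk G P → NoLeftWalkOfLength1or2 G P →
                 Reduction G P
Reduction-refl {G = G} {P} connected complete short =
  reduction G connected P complete short (id , id , λ e → refl) refl λ v → refl

Reduction-lift : ∀ {S} {G₁ G : GenGraph S} {P₁ P} → EdgeRemoval G₁ G → genus G₁ P₁ ≡ genus G P →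
                 (∀ v → reducedValence G₁ v ≡ reducedValence G v) → Reduction G₁ P₁ → Reduction G P
Reduction-lift {G₁ = G₁} {G} removal₁ genus₁ valence₁
  (reduction G₂ connected P₂ complete short removal₂ genus₂ valence₂) =
  reduction G₂ connected P₂ complete short (EdgeRemoval-trans {G₂ = G₂} {G₁} {G} removal₂ removal₁)
            (trans genus₂ genus₁) (λ v → trans (valence₂ v) (valence₁ v))

reduce : ∀ {S} A (ends : Fin A → Fin S × Fin S) → Connected (graph ends) → 3 ≤ S →
         (P : Polarization (graph ends)) → HasCompleteLeftWalk (graph ends) P → Reduction (graph ends) P
reduce zero ends connected _ P complete = Reduction-refl connected complete λ { (() , _) }
reduce (suc A) ends connected 3≤S P complete with any-dart? (λ d → τ (graph ends) P d ≟ᴰ d)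
... | yes (x , τx≡x) =
  Reduction-lift edgeRemoval genus-preserved (reducedValence-deleteEdge redundant)
    (reduce A (ends ∘ punchIn (proj₁ x)) (connected-deleteEdge redundant connected) 3≤S
            (deletePolarization P) (complete′ complete))
  where
  open EdgeDeletion ends x
  open LeftWalkOfLength1 ends x connected 3≤S P τx≡x
... | no no-fixed with any-dart? (λ d → τ (graph ends) P (τ (graph ends) P d) ≟ᴰ d)
...   | yes (x , ττx≡x) =
  Reduction-lift edgeRemoval genus-preserved (reducedValence-deleteEdge redundant)
    (reduce A (ends ∘ punchIn (proj₁ x)) (connected-deleteEdge redundant connected) 3≤S
            (deletePolarization P) (complete′ complete))
  where
  open EdgeDeletion ends x
  open LeftWalkOfLength2 ends x connected 3≤S P (λ d τd≡d → no-fixed (d , τd≡d)) ττx≡x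
...   | no no-2-cycle =
  Reduction-refl connected complete λ d → (λ τd≡d → no-fixed (d , τd≡d)) , (λ ττd≡d → no-2-cycle (d , ττd≡d))

lemma5p1 : {S : ℕ} (G : GenGraph S) → Connected G → (P : Polarization G) →
    HasCompleteLeftWalk G P → 3 ≤ S →
    Σ (GenGraph S) λ G' → Connected G' × Σ (Polarization G') λ P' →
      HasCompleteLeftWalk G' P' × NoLeftWalkOfLength1or2 G' P' ×
      EdgeRemoval G' G × genus G' P' ≡ genus G P ×
      (∀ (v : Fin S) → reducedValence G' v ≡ reducedValence G v)
lemma5p1 G connected P complete 3≤S with reduce (GenGraph.A G) (GenGraph.ends G) connected 3≤S P complete
... | reduction G′ connected′ P′ complete′ short removal genus-≡ valence-≡ =
  G′ , connected′ , P′ , complete′ , short , removal , genus-≡ , valence-≡
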